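{- Let $m\ge 1$ be an integer and let $R_{n,k}^{(m)}(t)$ be as defined in the context. Then $R_{0,0}^{(m)}(t)=1$, $R_{n,k}^{(m)}(t)=0$ if $k>n$ or $k<0$, and for all $n\ge 0$ and all $k$, \[ R_{n+1,k}^{(m)}(t)=R_{n,k-1}^{(m)}(t)-\bigl((1+t)+mn\bigr)R_{n,k}^{(m)}(t)-mnt\,R_{n-1,k}^{(m)}(t), \] where the last term is absent (zero) when $n=0$.
   Context: For fixed positive integer $m$, the polynomials $R_{n,k}^{(m)}(t)$ are defined by $\sum_{n\ge k}R_{n,k}^{(m)}(t)\frac{z^n}{n!}=e^{ -tz}(1+mz)^{ -1/m}\frac{(\ln(1+mz))^k}{m^k k!}$ for $k\ge 0$. -}

module Defs where

open import Data.Nat as ℕ using (ℕ; zero; suc; _∸_; _!)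
open import Data.Nat.Properties using (_!≢0)
open import Data.Integer as ℤ using (ℤ; +_; -[1+_])
open import Data.Rational using (ℚ; 0ℚ; 1ℚ; _+_; _*_; _-_; -_; _/_)

sumTo : ℕ → (ℕ → ℚ) → ℚ
sumTo zero    f = 0ℚ
sumTo (suc n) f = sumTo n f + f n

prodTo : ℕ → (ℕ → ℚ) → ℚ
prodTo zero    f = 1ℚ
prodTo (suc n) f = prodTo n f * f n

powQ : ℚ → ℕ → ℚ
powQ x zero    = 1ℚ
powQ x (suc n) = powQ x n * x

fromℕ : ℕ → ℚ
fromℕ n = (+ n) / 1

inv! : ℕ → ℚ
inv! n = (+ 1) / (n !)
  where instance _ = n !≢0

-- Formal power series in z over ℚ, given by their ordinary coefficients
-- (coefficient of z^n).
Series : Set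
Series = ℕ → ℚ

_⊛_ : Series → Series → Series
(a ⊛ b) n = sumTo (suc n) (λ i → a i * b (n ∸ i))

infixl 7 _⊛_

oneS : Series
oneS zero    = 1ℚ
oneS (suc _) = 0ℚ

powS : Series → ℕ → Series
powS a zero    = oneS
powS a (suc k) = powS a k ⊛ a

scaleS : ℚ → Series → Series
scaleS c a n = c * a n

expNeg : ℚ → Series
expNeg t n = powQ (- t) n * inv! n

-- (1+mz)^{-1/m} = Σ binom(-1/m, n) m^n z^n,
-- binom(-1/m,n) m^n = Π_{i<n} (-1/m - i) m / (i+1) = Π_{i<n} (-(1+m i))/(i+1)
binomSeries : ℕ → Series
binomSeries m n = prodTo n (λ i → -[1+ m ℕ.* i ] / suc i)

-- ln(1+mz) / m = Σ_{n≥1} (-1)^{n-1} m^{n-1} z^n / n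
logOverM : ℕ → Series
logOverM m zero    = 0ℚ
logOverM m (suc n) = ((ℤ.- (+ 1)) ℤ.^ n ℤ.* (+ (m ℕ.^ n))) / suc n

genR : ℕ → ℕ → ℚ → Series
genR m k t = expNeg t ⊛ binomSeries m ⊛ scaleS (inv! k) (powS (logOverM m) k)

R : ℕ → ℕ → ℕ → ℚ → ℚ
R m n k t = fromℕ (n !) * genR m k t n

Rℤ : ℕ → ℕ → ℤ → ℚ → ℚ
Rℤ m n (+ k)      t = R m n k t
Rℤ m n -[1+ _ ] t = 0ℚ

-- Write F_k = E ⊛ B ⊛ L^k/k! for the generating function of R_{·,k}, where
-- E = e^{-tz}, B = (1+mz)^{-1/m} and L = ln(1+mz)/m, and let
-- Θ = (1+mz) d/dz act on formal power series.  Θ is a derivation, and the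
-- three factors satisfy first-order equations
--     Θ E = -t (1+mz) E,      Θ B = -B,      Θ L = 1,
-- so Θ(L^{k+1}) = (k+1) L^k and hence
--     Θ F_k = -t (1+mz) F_k - F_k + F_{k-1}        (F_{-1} = 0).
-- Comparing the coefficients of z^n and multiplying by n! gives exactly the
-- three-term recurrence of the theorem; the boundary values come from
-- R_{0,0} = 1 (by computation) and from L^k having no terms below z^k.

module Submission where

open import Defs
open import Data.Nat as ℕ using (ℕ; zero; suc; _≤_)
open import Data.Integer as ℤ using (ℤ; +_)
open import Data.Rational using (ℚ; 0ℚ; 1ℚ; _+_; _*_; _-_)
open import Data.Product using (_×_)
open import Relation.Binary.PropositionalEquality using (_≡_)

open import Data.Nat using (_∸_; _!; _<_; s≤s)
open import Data.Integer using (-[1+_])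
open import Data.Rational using (-_; _/_; toℚᵘ)
open import Data.Product using (_,_)
open import Relation.Binary.PropositionalEquality
  using (refl; sym; trans; cong; cong₂; subst; module ≡-Reasoning)
open import Relation.Nullary using (yes; no)
import Data.Rational.Properties as QP
import Data.Rational.Unnormalised as U
import Data.Rational.Unnormalised.Properties as UP
import Data.Integer.Properties as ZP
import Data.Nat.Properties as NP
open import Data.Rational.Solver using (module +-*-Solver)
open +-*-Solver

ι : ℤ → ℚ
ι z = z / 1

/-*-cancel : ∀ z d .{{_ : ℕ.NonZero d}} → (z / d) * ι (+ d) ≡ ι z
/-*-cancel z (suc d) = QP.toℚᵘ-injective (begin
   toℚᵘ ((z / suc d) * ι (+ suc d))
     ≈⟨ QP.toℚᵘ-homo-* (z / suc d) (ι (+ suc d)) ⟩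
   toℚᵘ (z / suc d) U.* toℚᵘ (ι (+ suc d))
     ≈⟨ UP.*-cong (QP.toℚᵘ-fromℚᵘ (U.mkℚᵘ z d)) (QP.toℚᵘ-fromℚᵘ (U.mkℚᵘ (+ suc d) 0)) ⟩
   U.mkℚᵘ z d U.* U.mkℚᵘ (+ suc d) 0
     ≈⟨ U.*≡* cross ⟩
   U.mkℚᵘ z 0
     ≈⟨ UP.≃-sym (QP.toℚᵘ-fromℚᵘ (U.mkℚᵘ z 0)) ⟩
   toℚᵘ (ι z) ∎)
  where
   open UP.≃-Reasoning
   cross : (z ℤ.* + suc d) ℤ.* + 1 ≡ z ℤ.* + suc (d ℕ.* 1)
   cross = trans (ZP.*-identityʳ _) (cong (λ x → z ℤ.* + suc x) (sym (NP.*-identityʳ d)))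

ι-+ : ∀ a b → ι (a ℤ.+ b) ≡ ι a + ι b
ι-+ a b = QP.toℚᵘ-injective (begin
   toℚᵘ (ι (a ℤ.+ b))        ≈⟨ QP.toℚᵘ-fromℚᵘ (U.mkℚᵘ (a ℤ.+ b) 0) ⟩
   U.mkℚᵘ (a ℤ.+ b) 0        ≈⟨ U.*≡* (cong (ℤ._* + 1) (cong₂ ℤ._+_ (sym (ZP.*-identityʳ a)) (sym (ZP.*-identityʳ b)))) ⟩
   U.mkℚᵘ a 0 U.+ U.mkℚᵘ b 0 ≈⟨ UP.≃-sym (UP.+-cong (QP.toℚᵘ-fromℚᵘ (U.mkℚᵘ a 0)) (QP.toℚᵘ-fromℚᵘ (U.mkℚᵘ b 0))) ⟩
   toℚᵘ (ι a) U.+ toℚᵘ (ι b) ≈⟨ UP.≃-sym (QP.toℚᵘ-homo-+ (ι a) (ι b)) ⟩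
   toℚᵘ (ι a + ι b)          ∎)
  where open UP.≃-Reasoning

ι-* : ∀ a b → ι (a ℤ.* b) ≡ ι a * ι b
ι-* a b = QP.toℚᵘ-injective (begin
   toℚᵘ (ι (a ℤ.* b))        ≈⟨ QP.toℚᵘ-fromℚᵘ (U.mkℚᵘ (a ℤ.* b) 0) ⟩
   U.mkℚᵘ (a ℤ.* b) 0        ≈⟨ U.*≡* refl ⟩
   U.mkℚᵘ a 0 U.* U.mkℚᵘ b 0 ≈⟨ UP.≃-sym (UP.*-cong (QP.toℚᵘ-fromℚᵘ (U.mkℚᵘ a 0)) (QP.toℚᵘ-fromℚᵘ (U.mkℚᵘ b 0))) ⟩
   toℚᵘ (ι a) U.* toℚᵘ (ι b) ≈⟨ UP.≃-sym (QP.toℚᵘ-homo-* (ι a) (ι b)) ⟩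
   toℚᵘ (ι a * ι b)          ∎)
  where open UP.≃-Reasoning

fromℕ-+ : ∀ a b → fromℕ (a ℕ.+ b) ≡ fromℕ a + fromℕ b
fromℕ-+ a b = ι-+ (+ a) (+ b)

fromℕ-* : ∀ a b → fromℕ (a ℕ.* b) ≡ fromℕ a * fromℕ b
fromℕ-* a b = trans (cong ι (ZP.pos-* a b)) (ι-* (+ a) (+ b))

fromℕ-suc! : ∀ n → fromℕ (suc n !) ≡ fromℕ (suc n) * fromℕ (n !)
fromℕ-suc! n = fromℕ-* (suc n) (n !)

inv!-inverse : ∀ n → inv! n * fromℕ (n !) ≡ 1ℚ
inv!-inverse n = /-*-cancel (+ 1) (n !) {{NP._!≢0 n}}

-- (n+1) / (n+1)! = 1 / n!; this drives the derivatives of e^{-tz} and L^k/k!.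
inv!-step : ∀ n → inv! (suc n) * fromℕ (suc n) ≡ inv! n
inv!-step n = begin
  x * s                  ≡⟨ sym (QP.*-identityʳ (x * s)) ⟩
  (x * s) * 1ℚ           ≡⟨ cong ((x * s) *_) (sym (trans (QP.*-comm f i) (inv!-inverse n))) ⟩
  (x * s) * (f * i)      ≡⟨ solve 4 (λ x s f i → (x :* s) :* (f :* i) := (x :* (s :* f)) :* i) refl x s f i ⟩
  (x * (s * f)) * i      ≡⟨ cong (λ p → (x * p) * i) (sym (fromℕ-suc! n)) ⟩
  (x * fromℕ (suc n !)) * i ≡⟨ cong (_* i) (inv!-inverse (suc n)) ⟩
  1ℚ * i                 ≡⟨ QP.*-identityˡ i ⟩
  i                      ∎
  where
   open ≡-Reasoning
   x = inv! (suc n)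
   s = fromℕ (suc n)
   f = fromℕ (n !)
   i = inv! n

sum-cong : ∀ n {f g : ℕ → ℚ} → (∀ i → i < n → f i ≡ g i) → sumTo n f ≡ sumTo n g
sum-cong zero    eq = refl
sum-cong (suc n) eq = cong₂ _+_ (sum-cong n (λ i i<n → eq i (NP.m<n⇒m<1+n i<n))) (eq n (NP.n<1+n n))

sum-+ : ∀ n (f g : ℕ → ℚ) → sumTo n (λ i → f i + g i) ≡ sumTo n f + sumTo n g
sum-+ zero    f g = refl
sum-+ (suc n) f g = trans (cong (_+ (f n + g n)) (sum-+ n f g))
  (solve 4 (λ a b c d → (a :+ b) :+ (c :+ d) := (a :+ c) :+ (b :+ d)) refl (sumTo n f) (sumTo n g) (f n) (g n))

sum-scale : ∀ n c (f : ℕ → ℚ) → sumTo n (λ i → c * f i) ≡ c * sumTo n f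
sum-scale zero    c f = sym (QP.*-zeroʳ c)
sum-scale (suc n) c f = trans (cong (_+ c * f n) (sum-scale n c f)) (sym (QP.*-distribˡ-+ c (sumTo n f) (f n)))

sum-zero : ∀ n (f : ℕ → ℚ) → (∀ i → i < n → f i ≡ 0ℚ) → sumTo n f ≡ 0ℚ
sum-zero zero    f eq = refl
sum-zero (suc n) f eq = trans (cong₂ _+_ (sum-zero n f (λ i i<n → eq i (NP.m<n⇒m<1+n i<n))) (eq n (NP.n<1+n n)))
                              (QP.+-identityˡ 0ℚ)

sum-shift : ∀ n (f : ℕ → ℚ) → sumTo (suc n) f ≡ f 0 + sumTo n (λ i → f (suc i))
sum-shift zero    f = QP.+-comm 0ℚ (f 0)
sum-shift (suc n) f = trans (cong (_+ f (suc n)) (sum-shift n f)) (QP.+-assoc (f 0) _ _)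

-- Formal power series: operations and the Cauchy product

infix 4 _≈_
_≈_ : Series → Series → Set
a ≈ b = ∀ n → a n ≡ b n

refl≈ : ∀ {a} → a ≈ a
refl≈ _ = refl

addS : Series → Series → Series
addS a b n = a n + b n

zeroS : Series
zeroS _ = 0ℚ

Sh : Series → Series
Sh a zero    = 0ℚ
Sh a (suc n) = a n

D : Series → Series
D a n = fromℕ (suc n) * a (suc n)

conv-cong : ∀ {a a' b b'} → a ≈ a' → b ≈ b' → (a ⊛ b) ≈ (a' ⊛ b')
conv-cong ha hb n = sum-cong (suc n) (λ i _ → cong₂ _*_ (ha i) (hb (n ∸ i)))

conv-addˡ : ∀ a b c → (addS a b ⊛ c) ≈ addS (a ⊛ c) (b ⊛ c)
conv-addˡ a b c n = trans (sum-cong (suc n) (λ i _ → QP.*-distribʳ-+ (c (n ∸ i)) (a i) (b i))) (sum-+ (suc n) _ _)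

conv-addʳ : ∀ a b c → (a ⊛ addS b c) ≈ addS (a ⊛ b) (a ⊛ c)
conv-addʳ a b c n = trans (sum-cong (suc n) (λ i _ → QP.*-distribˡ-+ (a i) (b (n ∸ i)) (c (n ∸ i)))) (sum-+ (suc n) _ _)

conv-scaleˡ : ∀ k a b → (scaleS k a ⊛ b) ≈ scaleS k (a ⊛ b)
conv-scaleˡ k a b n = trans (sum-cong (suc n) (λ i _ → QP.*-assoc k (a i) (b (n ∸ i))))
                            (sum-scale (suc n) k (λ i → a i * b (n ∸ i)))

conv-scaleʳ : ∀ k a b → (a ⊛ scaleS k b) ≈ scaleS k (a ⊛ b)
conv-scaleʳ k a b n = trans (sum-cong (suc n) (λ i _ → swap (a i) k (b (n ∸ i))))
                            (sum-scale (suc n) k (λ i → a i * b (n ∸ i)))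
  where
   swap : ∀ x y z → x * (y * z) ≡ y * (x * z)
   swap = solve 3 (λ x y z → x :* (y :* z) := y :* (x :* z)) refl

conv-Shˡ : ∀ a b → (Sh a ⊛ b) ≈ Sh (a ⊛ b)
conv-Shˡ a b zero    = trans (QP.+-identityˡ (0ℚ * b 0)) (QP.*-zeroˡ (b 0))
conv-Shˡ a b (suc n) = trans (sum-shift (suc n) (λ i → Sh a i * b (suc n ∸ i)))
  (trans (cong (_+ (a ⊛ b) n) (QP.*-zeroˡ (b (suc n)))) (QP.+-identityˡ ((a ⊛ b) n)))

conv-Shʳ : ∀ a b → (a ⊛ Sh b) ≈ Sh (a ⊛ b)
conv-Shʳ a b zero    = trans (QP.+-identityˡ (a 0 * 0ℚ)) (QP.*-zeroʳ (a 0))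
conv-Shʳ a b (suc n) = trans (cong₂ _+_ (sum-cong (suc n) inner) last) (QP.+-identityʳ ((a ⊛ b) n))
  where
   inner : ∀ i → i < suc n → a i * Sh b (suc n ∸ i) ≡ a i * b (n ∸ i)
   inner i i<1+n = cong (λ x → a i * Sh b x) (NP.+-∸-assoc 1 (NP.≤-pred i<1+n))
   last : a (suc n) * Sh b (suc n ∸ suc n) ≡ 0ℚ
   last = trans (cong (λ x → a (suc n) * Sh b x) (NP.n∸n≡0 n)) (QP.*-zeroʳ (a (suc n)))

conv-oneʳ : ∀ a → (a ⊛ oneS) ≈ a
conv-oneʳ a n = trans (cong₂ _+_ (sum-zero n (λ i → a i * oneS (n ∸ i)) early) last) (QP.+-identityˡ (a n))
  where
   oneS-pos : ∀ n i → i < n → oneS (n ∸ i) ≡ 0ℚ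
   oneS-pos (suc n) i i<1+n rewrite NP.+-∸-assoc 1 (NP.≤-pred i<1+n) = refl
   early : ∀ i → i < n → a i * oneS (n ∸ i) ≡ 0ℚ
   early i i<n = trans (cong (a i *_) (oneS-pos n i i<n)) (QP.*-zeroʳ (a i))
   last : a n * oneS (n ∸ n) ≡ a n
   last = trans (cong (λ x → a n * oneS x) (NP.n∸n≡0 n)) (QP.*-identityʳ (a n))

conv-zeroˡ : ∀ a b → a ≈ zeroS → (a ⊛ b) ≈ zeroS
conv-zeroˡ a b a≈0 n = sum-zero (suc n) (λ i → a i * b (n ∸ i))
  (λ i _ → trans (cong (_* b (n ∸ i)) (a≈0 i)) (QP.*-zeroˡ (b (n ∸ i))))

conv-zeroʳ : ∀ a b → b ≈ zeroS → (a ⊛ b) ≈ zeroS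
conv-zeroʳ a b b≈0 n = sum-zero (suc n) (λ i → a i * b (n ∸ i))
  (λ i _ → trans (cong (a i *_) (b≈0 (n ∸ i))) (QP.*-zeroʳ (a i)))

Sh-cong : ∀ {a b} → a ≈ b → Sh a ≈ Sh b
Sh-cong a≈b zero    = refl
Sh-cong a≈b (suc n) = a≈b n

Sh-add : ∀ a b → Sh (addS a b) ≈ addS (Sh a) (Sh b)
Sh-add a b zero    = sym (QP.+-identityʳ 0ℚ)
Sh-add a b (suc n) = refl

Sh-scale : ∀ c a → Sh (scaleS c a) ≈ scaleS c (Sh a)
Sh-scale c a zero    = sym (QP.*-zeroʳ c)
Sh-scale c a (suc n) = refl

Sh-zero : ∀ a → a ≈ zeroS → Sh a ≈ zeroS
Sh-zero a a≈0 zero    = refl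
Sh-zero a a≈0 (suc n) = a≈0 n

D-scale : ∀ c a → D (scaleS c a) ≈ scaleS c (D a)
D-scale c a n = solve 3 (λ s c x → s :* (c :* x) := c :* (s :* x)) refl (fromℕ (suc n)) c (a (suc n))

-- In the coefficient of z^n one splits the
-- weight n+1 = i + (n+1-i) of the term a_i b_{n+1-i}; the first part
-- re-indexes to (a' ⊛ b)_n, the second to (a ⊛ b')_n.
D-leibniz : ∀ a b → D (a ⊛ b) ≈ addS (D a ⊛ b) (a ⊛ D b)
D-leibniz a b n = begin
   fromℕ (suc n) * sumTo (suc (suc n)) T
     ≡⟨ sym (sum-scale (suc (suc n)) (fromℕ (suc n)) T) ⟩
   sumTo (suc (suc n)) (λ i → fromℕ (suc n) * T i)
     ≡⟨ sum-cong (suc (suc n)) split ⟩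
   sumTo (suc (suc n)) (λ i → fromℕ i * T i + fromℕ (suc n ∸ i) * T i)
     ≡⟨ sum-+ (suc (suc n)) _ _ ⟩
   sumTo (suc (suc n)) (λ i → fromℕ i * T i) + sumTo (suc (suc n)) (λ i → fromℕ (suc n ∸ i) * T i)
     ≡⟨ cong₂ _+_ left right ⟩
   (D a ⊛ b) n + (a ⊛ D b) n ∎
  where
   open ≡-Reasoning
   T : ℕ → ℚ
   T i = a i * b (suc n ∸ i)
   split : ∀ i → i < suc (suc n) → fromℕ (suc n) * T i ≡ fromℕ i * T i + fromℕ (suc n ∸ i) * T i
   split i i< = trans (cong (_* T i) (trans (cong fromℕ (sym (NP.m+[n∸m]≡n (NP.≤-pred i<)))) (fromℕ-+ i (suc n ∸ i))))
                      (QP.*-distribʳ-+ (T i) (fromℕ i) (fromℕ (suc n ∸ i)))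
   left : sumTo (suc (suc n)) (λ i → fromℕ i * T i) ≡ (D a ⊛ b) n
   left = begin
     sumTo (suc (suc n)) (λ i → fromℕ i * T i)           ≡⟨ sum-shift (suc n) (λ i → fromℕ i * T i) ⟩
     0ℚ * T 0 + sumTo (suc n) (λ i → fromℕ (suc i) * T (suc i))
       ≡⟨ cong (_+ sumTo (suc n) (λ i → fromℕ (suc i) * T (suc i))) (QP.*-zeroˡ (T 0)) ⟩
     0ℚ + sumTo (suc n) (λ i → fromℕ (suc i) * T (suc i)) ≡⟨ QP.+-identityˡ _ ⟩
     sumTo (suc n) (λ i → fromℕ (suc i) * T (suc i))      ≡⟨ sum-cong (suc n) (λ i _ → sym (QP.*-assoc (fromℕ (suc i)) (a (suc i)) (b (n ∸ i)))) ⟩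
     (D a ⊛ b) n ∎
   inner : ∀ i → i < suc n → fromℕ (suc n ∸ i) * T i ≡ a i * D b (n ∸ i)
   inner i i< rewrite NP.+-∸-assoc 1 (NP.≤-pred i<) =
     solve 3 (λ s x y → s :* (x :* y) := x :* (s :* y)) refl (fromℕ (suc (n ∸ i))) (a i) (b (suc (n ∸ i)))
   right : sumTo (suc (suc n)) (λ i → fromℕ (suc n ∸ i) * T i) ≡ (a ⊛ D b) n
   right = trans (cong₂ _+_ (sum-cong (suc n) inner)
                   (trans (cong (λ x → fromℕ x * T (suc n)) (NP.n∸n≡0 n)) (QP.*-zeroˡ (T (suc n)))))
                 (QP.+-identityʳ ((a ⊛ D b) n))

VanishesBelow : ℕ → Series → Set
VanishesBelow k a = ∀ n → n < k → a n ≡ 0ℚ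

-- Orders add under the Cauchy product: in a_i b_{n-i} with n < i₀ + j₀,
-- either i < i₀ or n - i < j₀.
conv-vanishes : ∀ {i₀ j₀} a b → VanishesBelow i₀ a → VanishesBelow j₀ b →
                VanishesBelow (i₀ ℕ.+ j₀) (a ⊛ b)
conv-vanishes {i₀} {j₀} a b a₀ b₀ n n<i₀+j₀ = sum-zero (suc n) (λ i → a i * b (n ∸ i)) term
  where
   term : ∀ i → i < suc n → a i * b (n ∸ i) ≡ 0ℚ
   term i i<1+n with i ℕ.<? i₀
   ... | yes i<i₀ = trans (cong (_* b (n ∸ i)) (a₀ i i<i₀)) (QP.*-zeroˡ (b (n ∸ i)))
   ... | no  i≮i₀ = trans (cong (a i *_) (b₀ (n ∸ i) n∸i<j₀)) (QP.*-zeroʳ (a i))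
     where
      i₀≤i = NP.≮⇒≥ i≮i₀
      n∸i<j₀ : n ∸ i < j₀
      n∸i<j₀ = NP.≤-<-trans (NP.∸-monoʳ-≤ n i₀≤i)
                 (subst (n ∸ i₀ <_) (NP.m+n∸m≡n i₀ j₀)
                   (NP.∸-monoˡ-< n<i₀+j₀ (NP.≤-trans i₀≤i (NP.≤-pred i<1+n))))

powS-vanishes : ∀ a → VanishesBelow 1 a → ∀ k → VanishesBelow k (powS a k)
powS-vanishes a a₀ zero    n ()
powS-vanishes a a₀ (suc k) = subst (λ j → VanishesBelow j (powS a (suc k))) (NP.+-comm k 1)
                                   (conv-vanishes (powS a k) a (powS-vanishes a a₀ k) a₀)

egf : Series → ℕ → ℚ
egf F n = fromℕ (n !) * F n

-- The operator Θ = (1 + μz) d/dz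

module Theta (μ : ℚ) where

  M : Series → Series
  M a = addS a (scaleS μ (Sh a))

  Θ : Series → Series
  Θ a = M (D a)

  M-cong : ∀ {a b} → a ≈ b → M a ≈ M b
  M-cong a≈b n = cong₂ _+_ (a≈b n) (cong (μ *_) (Sh-cong a≈b n))

  M-convˡ : ∀ a b → M (a ⊛ b) ≈ (M a ⊛ b)
  M-convˡ a b n = sym (trans (conv-addˡ a (scaleS μ (Sh a)) b n)
     (cong (λ x → (a ⊛ b) n + x) (trans (conv-scaleˡ μ (Sh a) b n) (cong (μ *_) (conv-Shˡ a b n)))))

  M-convʳ : ∀ a b → M (a ⊛ b) ≈ (a ⊛ M b)
  M-convʳ a b n = sym (trans (conv-addʳ a b (scaleS μ (Sh b)) n)
     (cong (λ x → (a ⊛ b) n + x) (trans (conv-scaleʳ μ a (Sh b) n) (cong (μ *_) (conv-Shʳ a b n)))))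

  M-add : ∀ a b → M (addS a b) ≈ addS (M a) (M b)
  M-add a b n = trans (cong (λ x → (a n + b n) + μ * x) (Sh-add a b n))
    (solve 5 (λ u x y p q → (x :+ y) :+ u :* (p :+ q) := (x :+ u :* p) :+ (y :+ u :* q)) refl μ (a n) (b n) (Sh a n) (Sh b n))

  M-scale : ∀ c a → M (scaleS c a) ≈ scaleS c (M a)
  M-scale c a n = trans (cong (λ x → c * a n + μ * x) (Sh-scale c a n))
    (solve 4 (λ u c x p → c :* x :+ u :* (c :* p) := c :* (x :+ u :* p)) refl μ c (a n) (Sh a n))

  Θ-scale : ∀ c a → Θ (scaleS c a) ≈ scaleS c (Θ a)
  Θ-scale c a n = trans (M-cong (D-scale c a) n) (M-scale c (D a) n)

  Θ-one : Θ oneS ≈ zeroS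
  Θ-one n = trans (cong₂ (λ x y → x + μ * y) (D0 n) (Sh-zero (D oneS) D0 n))
                  (solve 1 (λ u → con 0ℚ :+ u :* con 0ℚ := con 0ℚ) refl μ)
    where
     D0 : D oneS ≈ zeroS
     D0 n = QP.*-zeroʳ (fromℕ (suc n))

  -- Θ is a derivation, since d/dz is one and M commutes with products.
  Θ-leibniz : ∀ a b → Θ (a ⊛ b) ≈ addS (Θ a ⊛ b) (a ⊛ Θ b)
  Θ-leibniz a b n = trans (M-cong (D-leibniz a b) n)
    (trans (M-add (D a ⊛ b) (a ⊛ D b) n) (cong₂ _+_ (M-convˡ (D a) b n) (M-convʳ a (D b) n)))

  -- If Θ L = 1 then Θ(L^{k+1}) = (k+1) L^k: by Leibniz,
  -- Θ(L^k · L) = Θ(L^k) · L + L^k = k L^k + L^k.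
  Θ-power : ∀ L → Θ L ≈ oneS → ∀ k → Θ (powS L (suc k)) ≈ scaleS (fromℕ (suc k)) (powS L k)
  Θ-power L ΘL≈1 k n = begin
    Θ (powS L k ⊛ L) n                                 ≡⟨ Θ-leibniz (powS L k) L n ⟩
    (Θ (powS L k) ⊛ L) n + (powS L k ⊛ Θ L) n          ≡⟨ cong₂ _+_ (earlier k) lastFactor ⟩
    fromℕ k * powS L k n + powS L k n                  ≡⟨ solve 2 (λ c x → c :* x :+ x := (con 1ℚ :+ c) :* x) refl (fromℕ k) (powS L k n) ⟩
    (1ℚ + fromℕ k) * powS L k n                        ≡⟨ cong (_* powS L k n) (sym (fromℕ-+ 1 k)) ⟩
    fromℕ (suc k) * powS L k n                         ∎
    where
     open ≡-Reasoning
     earlier : ∀ k → (Θ (powS L k) ⊛ L) n ≡ fromℕ k * powS L k n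
     earlier zero    = trans (conv-zeroˡ (Θ oneS) L Θ-one n) (sym (QP.*-zeroˡ (oneS n)))
     earlier (suc j) = trans (conv-cong {b = L} (Θ-power L ΘL≈1 j) refl≈ n) (conv-scaleˡ (fromℕ (suc j)) (powS L j) L n)
     lastFactor : (powS L k ⊛ Θ L) n ≡ powS L k n
     lastFactor = trans (conv-cong {a = powS L k} refl≈ ΘL≈1 n) (conv-oneʳ (powS L k) n)

  Eqn : ℚ → Series → Series → Set
  Eqn t F P = Θ F ≈ addS (addS (scaleS (- t) (M F)) (scaleS (- 1ℚ) F)) P

  eqn⇒recurrence₀ : ∀ t F P → Eqn t F P → egf F 1 ≡ egf P 0 - (1ℚ + t) * egf F 0
  eqn⇒recurrence₀ t F P eqn = begin
    1ℚ * F 1                                  ≡⟨ solve 2 (λ u x → con 1ℚ :* x := con 1ℚ :* x :+ u :* con 0ℚ) refl μ (F 1) ⟩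
    1ℚ * F 1 + μ * 0ℚ                         ≡⟨ eqn 0 ⟩
    (- t * (F 0 + μ * 0ℚ) + - 1ℚ * F 0) + P 0 ≡⟨ solve 4 (λ t u x p → (:- t :* (x :+ u :* con 0ℚ) :+ :- con 1ℚ :* x) :+ p
                                                             := con 1ℚ :* p :- (con 1ℚ :+ t) :* (con 1ℚ :* x)) refl t μ (F 0) (P 0) ⟩
    1ℚ * P 0 - (1ℚ + t) * (1ℚ * F 0)          ∎
    where open ≡-Reasoning

  -- Its z^{n+1} coefficient,  (n+2) F_{n+2} + μ(n+1) F_{n+1}
  --   = -t (F_{n+1} + μ F_n) - F_{n+1} + P_{n+1},  multiplied by (n+1)!.
  eqn⇒recurrence : ∀ t F P → Eqn t F P → ∀ n →
    egf F (suc (suc n))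
      ≡ egf P (suc n) - ((1ℚ + t) + μ * fromℕ (suc n)) * egf F (suc n) - μ * fromℕ (suc n) * t * egf F n
  eqn⇒recurrence t F P eqn n = begin
    egf F (suc (suc n))
      ≡⟨ cong (_* F₂) (trans (fromℕ-suc! (suc n)) (cong (s₂ *_) (fromℕ-suc! n))) ⟩
    (s₂ * (s₁ * a)) * F₂
      ≡⟨ solve 6 (λ u s₁ s₂ a x₁ x₂ → (s₂ :* (s₁ :* a)) :* x₂ := (s₁ :* a) :* ((s₂ :* x₂ :+ u :* (s₁ :* x₁)) :- u :* (s₁ :* x₁)))
               refl μ s₁ s₂ a F₁ F₂ ⟩
    (s₁ * a) * (Θ F (suc n) - μ * (s₁ * F₁))
      ≡⟨ cong (λ z → (s₁ * a) * (z - μ * (s₁ * F₁))) (eqn (suc n)) ⟩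
    (s₁ * a) * (((- t * (F₁ + μ * F₀) + - 1ℚ * F₁) + P₁) - μ * (s₁ * F₁))
      ≡⟨ solve 7 (λ t u s₁ a x₀ x₁ p → (s₁ :* a) :* (((:- t :* (x₁ :+ u :* x₀) :+ :- con 1ℚ :* x₁) :+ p) :- u :* (s₁ :* x₁))
                   := (s₁ :* a) :* p :- ((con 1ℚ :+ t) :+ u :* s₁) :* ((s₁ :* a) :* x₁) :- u :* s₁ :* t :* (a :* x₀))
               refl t μ s₁ a F₀ F₁ P₁ ⟩
    (s₁ * a) * P₁ - ((1ℚ + t) + μ * s₁) * ((s₁ * a) * F₁) - μ * s₁ * t * (a * F₀)
      ≡⟨ cong (λ f → f * P₁ - ((1ℚ + t) + μ * s₁) * (f * F₁) - μ * s₁ * t * (a * F₀)) (sym (fromℕ-suc! n)) ⟩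
    egf P (suc n) - ((1ℚ + t) + μ * s₁) * egf F (suc n) - μ * s₁ * t * egf F n ∎
    where
     open ≡-Reasoning
     s₁ = fromℕ (suc n)
     s₂ = fromℕ (suc (suc n))
     a  = fromℕ (n !)
     F₀ = F n
     F₁ = F (suc n)
     F₂ = F (suc (suc n))
     P₁ = P (suc n)

module Factors (m : ℕ) (t : ℚ) where

  μ : ℚ
  μ = fromℕ m

  open Theta μ public

  E B L : Series
  E = expNeg t
  B = binomSeries m
  L = logOverM m

  D-exp : D E ≈ scaleS (- t) E
  D-exp n = trans (solve 4 (λ s p c u → s :* ((p :* c) :* u) := c :* (p :* (u :* s))) refl
                             (fromℕ (suc n)) (powQ (- t) n) (- t) (inv! (suc n)))
                  (cong (λ z → - t * (powQ (- t) n * z)) (inv!-step n))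

  Θ-exp : Θ E ≈ scaleS (- t) (M E)
  Θ-exp n = trans (M-cong D-exp n) (M-scale (- t) E n)

  binom-ratio : ∀ n → fromℕ (suc n) * B (suc n) ≡ - (1ℚ + μ * fromℕ n) * B n
  binom-ratio n = begin
    fromℕ (suc n) * (B n * r)                 ≡⟨ solve 3 (λ s b r → s :* (b :* r) := b :* (r :* s)) refl (fromℕ (suc n)) (B n) r ⟩
    B n * (r * fromℕ (suc n))                 ≡⟨ cong (B n *_) (/-*-cancel -[1+ m ℕ.* n ] (suc n)) ⟩
    B n * (- ι (+ suc (m ℕ.* n)))             ≡⟨ cong (λ x → B n * (- x)) (trans (ι-+ (+ 1) (+ (m ℕ.* n))) (cong (λ x → 1ℚ + x) (fromℕ-* m n))) ⟩
    B n * (- (1ℚ + μ * fromℕ n))              ≡⟨ QP.*-comm (B n) _ ⟩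
    - (1ℚ + μ * fromℕ n) * B n                ∎
    where
     open ≡-Reasoning
     r = -[1+ m ℕ.* n ] / suc n

  Θ-binom : Θ B ≈ scaleS (- 1ℚ) B
  Θ-binom zero    = trans (cong (_+ μ * 0ℚ) (binom-ratio 0))
    (solve 2 (λ u b → :- (con 1ℚ :+ u :* con 0ℚ) :* b :+ u :* con 0ℚ := :- con 1ℚ :* b) refl μ (B 0))
  Θ-binom (suc j) = trans (cong (_+ μ * D B j) (binom-ratio (suc j)))
    (solve 3 (λ u s b → :- (con 1ℚ :+ u :* s) :* b :+ u :* (s :* b) := :- con 1ℚ :* b) refl μ (fromℕ (suc j)) (B (suc j)))

  -- (n+1) L_{n+1} = (-1)^n m^n, the coefficients of 1/(1+mz).
  sign : ℕ → ℚ
  sign n = ι ((ℤ.- (+ 1)) ℤ.^ n)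

  log-coeff : ∀ n → fromℕ (suc n) * L (suc n) ≡ sign n * fromℕ (m ℕ.^ n)
  log-coeff n = trans (QP.*-comm (fromℕ (suc n)) (L (suc n)))
                      (trans (/-*-cancel ((ℤ.- (+ 1)) ℤ.^ n ℤ.* (+ (m ℕ.^ n))) (suc n))
                             (ι-* ((ℤ.- (+ 1)) ℤ.^ n) (+ (m ℕ.^ n))))

  -- (1+mz) L' = 1: consecutive coefficients of L' cancel after multiplying by 1+mz.
  Θ-log : Θ L ≈ oneS
  Θ-log zero    = trans (cong (_+ μ * 0ℚ) (log-coeff 0)) (solve 1 (λ u → con 1ℚ :* con 1ℚ :+ u :* con 0ℚ := con 1ℚ) refl μ)
  Θ-log (suc j) = trans (cong₂ (λ x y → x + μ * y) (trans (log-coeff (suc j)) next) (log-coeff j))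
    (solve 3 (λ u s p → (:- con 1ℚ :* s) :* (u :* p) :+ u :* (s :* p) := con 0ℚ) refl μ (sign j) (fromℕ (m ℕ.^ j)))
    where
     next : sign (suc j) * fromℕ (m ℕ.^ suc j) ≡ (- 1ℚ * sign j) * (μ * fromℕ (m ℕ.^ j))
     next = cong₂ _*_ (ι-* (ℤ.- (+ 1)) ((ℤ.- (+ 1)) ℤ.^ j)) (fromℕ-* m (m ℕ.^ j))

  G : Series
  G = E ⊛ B

  Θ-G : Θ G ≈ addS (scaleS (- t) (M G)) (scaleS (- 1ℚ) G)
  Θ-G n = trans (Θ-leibniz E B n) (cong₂ _+_ expPart binomPart)
    where
     expPart : (Θ E ⊛ B) n ≡ - t * M G n
     expPart = trans (conv-cong {b = B} Θ-exp refl≈ n)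
                     (trans (conv-scaleˡ (- t) (M E) B n) (cong (- t *_) (sym (M-convˡ E B n))))
     binomPart : (E ⊛ Θ B) n ≡ - 1ℚ * G n
     binomPart = trans (conv-cong {a = E} refl≈ Θ-binom n) (conv-scaleʳ (- 1ℚ) E B n)

  Q : ℕ → Series
  Q k = scaleS (inv! k) (powS L k)

  Θ-Q₀ : Θ (Q 0) ≈ zeroS
  Θ-Q₀ n = trans (Θ-scale (inv! 0) oneS n) (trans (cong (inv! 0 *_) (Θ-one n)) (QP.*-zeroʳ (inv! 0)))

  Θ-Q : ∀ k → Θ (Q (suc k)) ≈ Q k
  Θ-Q k n = begin
    Θ (Q (suc k)) n                                   ≡⟨ Θ-scale (inv! (suc k)) (powS L (suc k)) n ⟩
    inv! (suc k) * Θ (powS L (suc k)) n               ≡⟨ cong (inv! (suc k) *_) (Θ-power L Θ-log k n) ⟩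
    inv! (suc k) * (fromℕ (suc k) * powS L k n)       ≡⟨ sym (QP.*-assoc (inv! (suc k)) (fromℕ (suc k)) (powS L k n)) ⟩
    (inv! (suc k) * fromℕ (suc k)) * powS L k n       ≡⟨ cong (_* powS L k n) (inv!-step k) ⟩
    Q k n                                             ∎
    where open ≡-Reasoning

  F : ℕ → Series
  F k = G ⊛ Q k

  Fprev : ℕ → Series
  Fprev zero    = zeroS
  Fprev (suc k) = F k

  Θ-F : ∀ k → Eqn t (F k) (Fprev k)
  Θ-F k n = trans (Θ-leibniz G (Q k) n) (cong₂ _+_ fromG (fromQ k))
    where
     open ≡-Reasoning
     fromG : (Θ G ⊛ Q k) n ≡ - t * M (F k) n + - 1ℚ * F k n
     fromG = begin
       (Θ G ⊛ Q k) n
         ≡⟨ conv-cong {b = Q k} Θ-G refl≈ n ⟩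
       (addS (scaleS (- t) (M G)) (scaleS (- 1ℚ) G) ⊛ Q k) n
         ≡⟨ conv-addˡ (scaleS (- t) (M G)) (scaleS (- 1ℚ) G) (Q k) n ⟩
       (scaleS (- t) (M G) ⊛ Q k) n + (scaleS (- 1ℚ) G ⊛ Q k) n
         ≡⟨ cong₂ _+_ (conv-scaleˡ (- t) (M G) (Q k) n) (conv-scaleˡ (- 1ℚ) G (Q k) n) ⟩
       - t * (M G ⊛ Q k) n + - 1ℚ * F k n
         ≡⟨ cong (λ x → - t * x + - 1ℚ * F k n) (sym (M-convˡ G (Q k) n)) ⟩
       - t * M (F k) n + - 1ℚ * F k n ∎
     fromQ : ∀ k → (G ⊛ Θ (Q k)) n ≡ Fprev k n
     fromQ zero    = conv-zeroʳ G (Θ (Q 0)) Θ-Q₀ n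
     fromQ (suc j) = conv-cong {a = G} refl≈ (Θ-Q j) n

  -- L has no constant term, so F_k has no terms below z^k.
  F-vanishes : ∀ k → VanishesBelow k (F k)
  F-vanishes k = conv-vanishes {0} G (Q k) (λ _ ()) Q-vanishes
    where
     L₀ : VanishesBelow 1 L
     L₀ zero    _           = refl
     L₀ (suc _) (s≤s ())
     Q-vanishes : VanishesBelow k (Q k)
     Q-vanishes n n<k = trans (cong (inv! k *_) (powS-vanishes L L₀ k n n<k)) (QP.*-zeroʳ (inv! k))

R-prev : ∀ m n k t → Rℤ m n (+ k ℤ.- + 1) t ≡ egf (Factors.Fprev m t k) n
R-prev m n zero    t = sym (QP.*-zeroʳ (fromℕ (n !)))
R-prev m n (suc k) t = refl

-- R_{n,k} = 0 for k > n, since F_k starts at z^k.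
R-vanishes-above : ∀ m n k t → (+ n) ℤ.< k → Rℤ m n k t ≡ 0ℚ
R-vanishes-above m n (+ k) t (ℤ.+<+ n<k) =
  trans (cong (fromℕ (n !) *_) (Factors.F-vanishes m t k n n<k)) (QP.*-zeroʳ (fromℕ (n !)))

R-vanishes-below : ∀ m n k t → k ℤ.< (+ 0) → Rℤ m n k t ≡ 0ℚ
R-vanishes-below m n -[1+ j ] t _         = refl
R-vanishes-below m n (+ j)    t (ℤ.+<+ ())

-- The recurrences are the coefficient forms of Θ-F; for k < 0 every term is 0.
R-recurrence₀ : ∀ m k t → Rℤ m 1 k t ≡ Rℤ m 0 (k ℤ.- (+ 1)) t - (1ℚ + t) * Rℤ m 0 k t
R-recurrence₀ m (+ k)    t = trans (eqn⇒recurrence₀ t (F k) (Fprev k) (Θ-F k))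
                                   (cong (λ z → z - (1ℚ + t) * Rℤ m 0 (+ k) t) (sym (R-prev m 0 k t)))
  where open Factors m t
R-recurrence₀ m -[1+ j ] t = solve 1 (λ t → con 0ℚ := con 0ℚ :- (con 1ℚ :+ t) :* con 0ℚ) refl t

R-recurrence : ∀ m n k t →
  Rℤ m (suc (suc n)) k t
    ≡ Rℤ m (suc n) (k ℤ.- (+ 1)) t
      - ((1ℚ + t) + fromℕ (m ℕ.* suc n)) * Rℤ m (suc n) k t
      - fromℕ (m ℕ.* suc n) * t * Rℤ m n k t
R-recurrence m n (+ k) t = begin
  Rℤ m (suc (suc n)) (+ k) t
    ≡⟨ eqn⇒recurrence t (F k) (Fprev k) (Θ-F k) n ⟩
  egf (Fprev k) (suc n) - ((1ℚ + t) + μ * fromℕ (suc n)) * Rℤ m (suc n) (+ k) t - μ * fromℕ (suc n) * t * Rℤ m n (+ k) t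
    ≡⟨ cong₂ (λ p c → p - ((1ℚ + t) + c) * Rℤ m (suc n) (+ k) t - c * t * Rℤ m n (+ k) t)
             (sym (R-prev m (suc n) k t)) (sym (fromℕ-* m (suc n))) ⟩
  Rℤ m (suc n) (+ k ℤ.- (+ 1)) t - ((1ℚ + t) + fromℕ (m ℕ.* suc n)) * Rℤ m (suc n) (+ k) t - fromℕ (m ℕ.* suc n) * t * Rℤ m n (+ k) t ∎
  where
   open Factors m t
   open ≡-Reasoning
R-recurrence m n -[1+ j ] t =
  solve 2 (λ t c → con 0ℚ := con 0ℚ :- ((con 1ℚ :+ t) :+ c) :* con 0ℚ :- c :* t :* con 0ℚ) refl t (fromℕ (m ℕ.* suc n))

mainTheorem13 : (m : ℕ) → 1 ≤ m →
    ((t : ℚ) → Rℤ m 0 (+ 0) t ≡ 1ℚ)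
    × ((n : ℕ) (k : ℤ) (t : ℚ) → (+ n) ℤ.< k → Rℤ m n k t ≡ 0ℚ)
    × ((n : ℕ) (k : ℤ) (t : ℚ) → k ℤ.< (+ 0) → Rℤ m n k t ≡ 0ℚ)
    × ((k : ℤ) (t : ℚ) →
         Rℤ m 1 k t ≡ Rℤ m 0 (k ℤ.- (+ 1)) t - (1ℚ + t) * Rℤ m 0 k t)
    × ((n : ℕ) (k : ℤ) (t : ℚ) →
         Rℤ m (suc (suc n)) k t
           ≡ Rℤ m (suc n) (k ℤ.- (+ 1)) t
             - ((1ℚ + t) + fromℕ (m ℕ.* suc n)) * Rℤ m (suc n) k t
             - fromℕ (m ℕ.* suc n) * t * Rℤ m n k t)
-- R_{0,0} = 1 holds by computation.
mainTheorem13 m _ =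
  (λ t → refl) ,
  R-vanishes-above m ,
  R-vanishes-below m ,
  R-recurrence₀ m ,
  R-recurrence m
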